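{- For every $n\ge1$, the last element $L_{2n}-1$ of $\Lambda_{2n-1}$ and the first two elements $L_{2n},L_{2n}+1$ of $\Lambda_{2n}$ form a trident, i.e. $\beta^-(L_{2n}-1)=\beta^-(L_{2n})=\beta^-(L_{2n}+1)$.
   Context: Let $\varphi=(1+\sqrt5)/2$. Every integer $N\ge1$ has a unique base phi expansion $N=\sum_{i\in\mathbb Z} d_i\varphi^i$ with $d_i\in\{0,1\}$, finitely many nonzero, and $d_id_{i+1}=0$ for all $i$; with $R$ the smallest index with $d_R=1$, $\beta^-(N)=d_{ -1}d_{ -2}\cdots d_R$ (the digits at negative powers). Lucas numbers: $L_0=2$, $L_1=1$, $L_n=L_{n-1}+L_{n-2}$; $\Lambda_{2n}=[L_{2n},L_{2n+1}]$, $\Lambda_{2n+1}=[L_{2n+1}+1,L_{2n+2}-1]$ (integer intervals). A trident is a triple of consecutive integers $N,N+1,N+2$ with $\beta^-(N)=\beta^-(N+1)=\beta^-(N+2)$. -}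

module Defs where

open import Data.Bool using (Bool; true; false; if_then_else_)
open import Data.Nat as ℕ using (ℕ; zero; suc)
open import Data.Integer as ℤ using (ℤ; +_; -[1+_]; ∣_∣)
open import Data.List using (List; []; _∷_; map; reverse; upTo)
open import Data.Product using (_×_; _,_; Σ)
open import Relation.Binary.PropositionalEquality using (_≡_)

L : ℕ → ℕ
L zero = 2
L (suc zero) = 1
L (suc (suc n)) = L (suc n) ℕ.+ L n

-- The ring ℤ[φ] (φ² = φ + 1): the pair (a , b) stands for a + bφ.
ZPhi : Set
ZPhi = ℤ × ℤ

_⊕_ : ZPhi → ZPhi → ZPhi
(a , b) ⊕ (c , d) = (a ℤ.+ c , b ℤ.+ d)

zeroΦ : ZPhi
zeroΦ = (+ 0 , + 0)

oneΦ : ZPhi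
oneΦ = (+ 1 , + 0)

-- multiplication by φ : (a + bφ)φ = b + (a+b)φ
mulφ : ZPhi → ZPhi
mulφ (a , b) = (b , a ℤ.+ b)

-- division by φ (φ⁻¹ = φ - 1) : (a + bφ)/φ = (b - a) + aφ
divφ : ZPhi → ZPhi
divφ (a , b) = (b ℤ.- a , a)

iter : (ZPhi → ZPhi) → ℕ → ZPhi → ZPhi
iter f zero x = x
iter f (suc n) x = f (iter f n x)

phiPow : ℤ → ZPhi
phiPow (+ n) = iter mulφ n oneΦ
phiPow -[1+ n ] = iter divφ (suc n) oneΦ

digitVal : (ℤ → Bool) → ℤ → ZPhi
digitVal d i = if d i then phiPow i else zeroΦ

sumRange : (ℤ → Bool) → ℤ → ℕ → ZPhi
sumRange d lo zero = zeroΦ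
sumRange d lo (suc k) = digitVal d (lo ℤ.+ + k) ⊕ sumRange d lo k

record Expansion (N : ℕ) : Set where
  field
    d      : ℤ → Bool
    M      : ℕ
    finite : ∀ i → M ℕ.< ∣ i ∣ → d i ≡ false
    noAdj  : ∀ i → d i ≡ true → d (i ℤ.+ + 1) ≡ false
    value  : sumRange d (ℤ.- (+ M)) (suc (2 ℕ.* M)) ≡ (+ N , + 0)

dropFalse : List Bool → List Bool
dropFalse [] = []
dropFalse (false ∷ xs) = dropFalse xs
dropFalse (true ∷ xs) = true ∷ xs

-- β⁻ : the word d_{-1} d_{-2} ⋯ d_R  (R = smallest index with d_R = 1),
-- obtained from d_{-1} ⋯ d_{-M} by deleting the trailing zeros.
betaMinus : {N : ℕ} → Expansion N → List Bool
betaMinus e = reverse (dropFalse (reverse (map (λ k → d (-[1+ k ])) (upTo M))))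
  where open Expansion e

-- N, N+1, N+2 form a trident: their base phi expansions exist, and
-- (for any choice of expansions -- they are unique) have equal β⁻.
Trident : ℕ → Set
Trident N =
  (Expansion N × Expansion (suc N) × Expansion (suc (suc N))) ×
  (∀ (e₀ : Expansion N) (e₁ : Expansion (suc N)) (e₂ : Expansion (suc (suc N))) →
     (betaMinus e₀ ≡ betaMinus e₁) × (betaMinus e₁ ≡ betaMinus e₂))

module Submission where

-- Let M = 2n. Binet's formula with ψ = -φ⁻¹ gives L_M = φ^M + φ^(-M), so L_M has the digits ±M,
-- L_M + 1 has in addition the digit 0, and L_M - 1 = (φ + φ³ + ⋯ + φ^(M-1)) + φ^(-M).
-- The three expansions share their only negative digit -M, hence their β⁻.  Base φ
-- expansions are unique: multiplied by φ^K and read through a + bφ ↦ a + 2b they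
-- become Zeckendorf representations, so any other choice of expansions has the same β⁻.

open import Defs
open import Data.Bool using (Bool; true; false; not; _∧_; _∨_; if_then_else_)
import Data.Bool.Properties as Boolₚ
open import Data.Nat as ℕ using (ℕ; zero; suc; _≤_; _<_; _∸_; _*_; _⊔_; z≤n; s≤s; _≟_; _<?_)
import Data.Nat.Properties as ℕₚ
import Data.Nat.Tactic.RingSolver as ℕ-Solver
open import Data.Integer as ℤ using (ℤ; +_; -[1+_]; ∣_∣)
import Data.Integer.Properties as ℤₚ
open import Data.Integer.Tactic.RingSolver using (solve-∀)
open import Algebra.Properties.AbelianGroup ℤₚ.+-0-abelianGroup using () renaming (∙-cancelˡ to +-cancelˡ)
open import Data.List using (List; []; _∷_; _++_; map; reverse; upTo)
import Data.List.Properties as Listₚ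
open import Data.Product using (Σ-syntax; _×_; _,_; proj₁; proj₂)
open import Data.Sum using (inj₁; inj₂)
open import Data.Empty using (⊥-elim)
open import Function using (_∘_; Equivalence)
open import Relation.Nullary using (does; yes; no)
open import Relation.Nullary.Decidable using (dec-true; dec-false)
open import Relation.Binary.PropositionalEquality
open ≡-Reasoning

-- Arithmetic in ℤ[φ]

⊕-identityˡ : ∀ x → zeroΦ ⊕ x ≡ x
⊕-identityˡ (a , b) = cong₂ _,_ (ℤₚ.+-identityˡ a) (ℤₚ.+-identityˡ b)

⊕-identityʳ : ∀ x → x ⊕ zeroΦ ≡ x
⊕-identityʳ (a , b) = cong₂ _,_ (ℤₚ.+-identityʳ a) (ℤₚ.+-identityʳ b)

⊕-assoc : ∀ x y z → (x ⊕ y) ⊕ z ≡ x ⊕ (y ⊕ z)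
⊕-assoc (a , b) (c , d) (e , f) = cong₂ _,_ (ℤₚ.+-assoc a c e) (ℤₚ.+-assoc b d f)

⊕-comm : ∀ x y → x ⊕ y ≡ y ⊕ x
⊕-comm (a , b) (c , d) = cong₂ _,_ (ℤₚ.+-comm a c) (ℤₚ.+-comm b d)

⊕-exchange : ∀ x y z → (x ⊕ y) ⊕ z ≡ y ⊕ (x ⊕ z)
⊕-exchange x y z = trans (cong (_⊕ z) (⊕-comm x y)) (⊕-assoc y x z)

⊕-cancelˡ : ∀ x y z → x ⊕ y ≡ x ⊕ z → y ≡ z
⊕-cancelˡ (a , b) (c , d) (e , f) eq =
  cong₂ _,_ (+-cancelˡ a c e (cong proj₁ eq)) (+-cancelˡ b d f (cong proj₂ eq))

⊕-interchange : ∀ w x y z → (w ⊕ x) ⊕ (y ⊕ z) ≡ (w ⊕ y) ⊕ (x ⊕ z)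
⊕-interchange (a , b) (c , d) (e , f) (g , h) = cong₂ _,_ (lemma a c e g) (lemma b d f h)
  where
  lemma : ∀ a b c d → (a ℤ.+ b) ℤ.+ (c ℤ.+ d) ≡ (a ℤ.+ c) ℤ.+ (b ℤ.+ d)
  lemma = solve-∀

mulφ-⊕ : ∀ x y → mulφ (x ⊕ y) ≡ mulφ x ⊕ mulφ y
mulφ-⊕ (a , b) (c , d) = cong₂ _,_ refl (lemma a b c d)
  where
  lemma : ∀ a b c d → (a ℤ.+ c) ℤ.+ (b ℤ.+ d) ≡ (a ℤ.+ b) ℤ.+ (c ℤ.+ d)
  lemma = solve-∀

mulφ∘divφ : ∀ x → mulφ (divφ x) ≡ x
mulφ∘divφ (a , b) = cong₂ _,_ refl (lemma a b)
  where
  lemma : ∀ a b → (b ℤ.- a) ℤ.+ a ≡ b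
  lemma = solve-∀

mulφ² : ∀ x → mulφ (mulφ x) ≡ mulφ x ⊕ x
mulφ² (a , b) = cong₂ _,_ (ℤₚ.+-comm a b) (lemma a b)
  where
  lemma : ∀ a b → b ℤ.+ (a ℤ.+ b) ≡ (a ℤ.+ b) ℤ.+ b
  lemma = solve-∀

-- multiplication by the conjugate ψ = 1 - φ = -φ⁻¹: (a + bφ)ψ = (a - b) - aφ
mulψ : ZPhi → ZPhi
mulψ (a , b) = (a ℤ.- b , ℤ.- a)

mulψ² : ∀ x → mulψ (mulψ x) ≡ mulψ x ⊕ x
mulψ² (a , b) = cong₂ _,_ (lemma₁ a b) (lemma₂ a b)
  where
  lemma₁ : ∀ a b → (a ℤ.- b) ℤ.- ℤ.- a ≡ (a ℤ.- b) ℤ.+ a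
  lemma₁ = solve-∀
  lemma₂ : ∀ a b → ℤ.- (a ℤ.- b) ≡ ℤ.- a ℤ.+ b
  lemma₂ = solve-∀

mulψ²≡divφ² : ∀ x → mulψ (mulψ x) ≡ divφ (divφ x)
mulψ²≡divφ² (a , b) = cong₂ _,_ (lemma₁ a b) (lemma₂ a b)
  where
  lemma₁ : ∀ a b → (a ℤ.- b) ℤ.- ℤ.- a ≡ a ℤ.- (b ℤ.- a)
  lemma₁ = solve-∀
  lemma₂ : ∀ a b → ℤ.- (a ℤ.- b) ≡ b ℤ.- a
  lemma₂ = solve-∀

infix 25 φ^_ φ^-_ ψ^_
φ^_ φ^-_ ψ^_ : ℕ → ZPhi
φ^ k = phiPow (+ k)
φ^- k = iter divφ k oneΦ
ψ^ k = iter mulψ k oneΦ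

phiPow-suc : ∀ i → phiPow (i ℤ.+ + 1) ≡ mulφ (phiPow i)
phiPow-suc (+ n) = cong (λ m → iter mulφ m oneΦ) (ℕₚ.+-comm n 1)
phiPow-suc -[1+ zero ] = sym (mulφ∘divφ oneΦ)
phiPow-suc -[1+ suc n ] = sym (mulφ∘divφ _)

mulφ^-phiPow : ∀ m i → iter mulφ m (phiPow i) ≡ phiPow (i ℤ.+ + m)
mulφ^-phiPow zero i = cong phiPow (sym (ℤₚ.+-identityʳ i))
mulφ^-phiPow (suc m) i = begin
  mulφ (iter mulφ m (phiPow i))  ≡⟨ cong mulφ (mulφ^-phiPow m i) ⟩
  mulφ (phiPow (i ℤ.+ + m))      ≡⟨ phiPow-suc (i ℤ.+ + m) ⟨
  phiPow (i ℤ.+ + m ℤ.+ + 1)     ≡⟨ cong phiPow (ℤₚ.+-assoc i (+ m) (+ 1)) ⟩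
  phiPow (i ℤ.+ + (m ℕ.+ 1))     ≡⟨ cong (λ k → phiPow (i ℤ.+ + k)) (ℕₚ.+-comm m 1) ⟩
  phiPow (i ℤ.+ + suc m)         ∎

mulφ^-⊕ : ∀ m x y → iter mulφ m (x ⊕ y) ≡ iter mulφ m x ⊕ iter mulφ m y
mulφ^-⊕ zero x y = refl
mulφ^-⊕ (suc m) x y = trans (cong mulφ (mulφ^-⊕ m x y)) (mulφ-⊕ (iter mulφ m x) (iter mulφ m y))

mulφ^-zero : ∀ m → iter mulφ m zeroΦ ≡ zeroΦ
mulφ^-zero zero = refl
mulφ^-zero (suc m) = cong mulφ (mulφ^-zero m)

lucas-binet : ∀ k → φ^ k ⊕ ψ^ k ≡ (+ L k , + 0)
lucas-binet zero = refl
lucas-binet (suc zero) = refl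
lucas-binet (suc (suc k)) = begin
  mulφ (φ^ suc k) ⊕ mulψ (ψ^ suc k)        ≡⟨ cong₂ _⊕_ (mulφ² (φ^ k)) (mulψ² (ψ^ k)) ⟩
  (φ^ suc k ⊕ φ^ k) ⊕ (ψ^ suc k ⊕ ψ^ k)    ≡⟨ ⊕-interchange (φ^ suc k) (φ^ k) (ψ^ suc k) (ψ^ k) ⟩
  (φ^ suc k ⊕ ψ^ suc k) ⊕ (φ^ k ⊕ ψ^ k)    ≡⟨ cong₂ _⊕_ (lucas-binet (suc k)) (lucas-binet k) ⟩
  (+ L (suc (suc k)) , + 0)                ∎

ψ^even≡φ^-even : ∀ j → ψ^ (2 * j) ≡ φ^- (2 * j)
ψ^even≡φ^-even zero = refl
ψ^even≡φ^-even (suc j) = begin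
  ψ^ (2 * suc j)             ≡⟨ cong ψ^_ (ℕₚ.*-suc 2 j) ⟩
  mulψ (mulψ (ψ^ (2 * j)))   ≡⟨ mulψ²≡divφ² (ψ^ (2 * j)) ⟩
  divφ (divφ (ψ^ (2 * j)))   ≡⟨ cong (divφ ∘ divφ) (ψ^even≡φ^-even j) ⟩
  divφ (divφ (φ^- (2 * j)))  ≡⟨ cong φ^-_ (ℕₚ.*-suc 2 j) ⟨
  φ^- (2 * suc j)            ∎

lucas-even : ∀ j → φ^ (2 * j) ⊕ φ^- (2 * j) ≡ (+ L (2 * j) , + 0)
lucas-even j = trans (cong (φ^ (2 * j) ⊕_) (sym (ψ^even≡φ^-even j))) (lucas-binet (2 * j))

digitVal-false : ∀ d i → d i ≡ false → digitVal d i ≡ zeroΦ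
digitVal-false d i di rewrite di = refl

sumRange-extendˡ : ∀ d {lo} lo' n → lo' ℤ.+ + 1 ≡ lo →
  sumRange d lo' (suc n) ≡ sumRange d lo n ⊕ digitVal d lo'
sumRange-extendˡ d lo' zero _ = begin
  digitVal d (lo' ℤ.+ + 0) ⊕ zeroΦ  ≡⟨ ⊕-identityʳ _ ⟩
  digitVal d (lo' ℤ.+ + 0)          ≡⟨ cong (digitVal d) (ℤₚ.+-identityʳ lo') ⟩
  digitVal d lo'                    ≡⟨ ⊕-identityˡ _ ⟨
  zeroΦ ⊕ digitVal d lo'            ∎
sumRange-extendˡ d {lo} lo' (suc n) lo'+1≡lo = begin
  digitVal d (lo' ℤ.+ + suc n) ⊕ sumRange d lo' (suc n)
    ≡⟨ cong₂ _⊕_ (cong (digitVal d) index) (sumRange-extendˡ d lo' n lo'+1≡lo) ⟩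
  digitVal d (lo ℤ.+ + n) ⊕ (sumRange d lo n ⊕ digitVal d lo')
    ≡⟨ ⊕-assoc (digitVal d (lo ℤ.+ + n)) _ _ ⟨
  (digitVal d (lo ℤ.+ + n) ⊕ sumRange d lo n) ⊕ digitVal d lo' ∎
  where
  index : lo' ℤ.+ + suc n ≡ lo ℤ.+ + n
  index = trans (sym (ℤₚ.+-assoc lo' (+ 1) (+ n))) (cong (ℤ._+ + n) lo'+1≡lo)

sumRange-++ : ∀ d lo a n → sumRange d lo (a ℕ.+ n) ≡ sumRange d (lo ℤ.+ + a) n ⊕ sumRange d lo a
sumRange-++ d lo a zero = trans (cong (sumRange d lo) (ℕₚ.+-identityʳ a)) (sym (⊕-identityˡ _))
sumRange-++ d lo a (suc n) = begin
  sumRange d lo (a ℕ.+ suc n)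
    ≡⟨ cong (sumRange d lo) (ℕₚ.+-suc a n) ⟩
  digitVal d (lo ℤ.+ + (a ℕ.+ n)) ⊕ sumRange d lo (a ℕ.+ n)
    ≡⟨ cong₂ _⊕_ (cong (digitVal d) (sym (ℤₚ.+-assoc lo (+ a) (+ n)))) (sumRange-++ d lo a n) ⟩
  digitVal d (lo ℤ.+ + a ℤ.+ + n) ⊕ (sumRange d (lo ℤ.+ + a) n ⊕ sumRange d lo a)
    ≡⟨ ⊕-assoc (digitVal d (lo ℤ.+ + a ℤ.+ + n)) _ _ ⟨
  sumRange d (lo ℤ.+ + a) (suc n) ⊕ sumRange d lo a ∎

-- Zeckendorf sums

fib : ℕ → ℕ
fib zero = 0
fib (suc zero) = 1
fib (suc (suc n)) = fib (suc n) ℕ.+ fib n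

zeckendorf : (ℕ → Bool) → ℕ → ℕ
zeckendorf w zero = 0
zeckendorf w (suc n) = (if w n then fib (2 ℕ.+ n) else 0) ℕ.+ zeckendorf w n

NoAdjacent : (ℕ → Bool) → Set
NoAdjacent w = ∀ k → w k ≡ true → w (suc k) ≡ false

zeckendorf<fib : ∀ {w} → NoAdjacent w → ∀ n → zeckendorf w n < fib (2 ℕ.+ n)
zeckendorf<fib {w} noAdj n = proj₁ (bounds n)
  where
  bounds : ∀ n → zeckendorf w n < fib (2 ℕ.+ n) × zeckendorf w (suc n) < fib (3 ℕ.+ n)
  bounds zero with w 0
  ... | true = s≤s z≤n , s≤s (s≤s z≤n)
  ... | false = s≤s z≤n , s≤s z≤n
  bounds (suc n) with bounds n
  ... | bound , bound₁ = bound₁ , next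
    where
    next : zeckendorf w (2 ℕ.+ n) < fib (4 ℕ.+ n)
    next with w (suc n) in wn₁
    ... | false = ℕₚ.<-≤-trans bound₁ (ℕₚ.m≤m+n (fib (3 ℕ.+ n)) (fib (2 ℕ.+ n)))
    ... | true with w n in wn
    ...   | false = ℕₚ.+-monoʳ-< (fib (3 ℕ.+ n)) bound
    ...   | true with () ← trans (sym (noAdj n wn)) wn₁

fib+zeckendorf≢zeckendorf : ∀ {v} → NoAdjacent v → ∀ n u → fib (2 ℕ.+ n) ℕ.+ zeckendorf u n ≢ zeckendorf v n
fib+zeckendorf≢zeckendorf noAdj n u eq =
  ℕₚ.<-irrefl refl (ℕₚ.<-≤-trans (zeckendorf<fib noAdj n) (ℕₚ.≤-trans (ℕₚ.m≤m+n _ _) (ℕₚ.≤-reflexive eq)))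

zeckendorf-suc-injective : ∀ {w w' n} → NoAdjacent w → NoAdjacent w' →
  zeckendorf w (suc n) ≡ zeckendorf w' (suc n) → w n ≡ w' n × zeckendorf w n ≡ zeckendorf w' n
zeckendorf-suc-injective {w} {w'} {n} noAdj noAdj' eq with w n | w' n
... | true | true = refl , ℕₚ.+-cancelˡ-≡ (fib (2 ℕ.+ n)) _ _ eq
... | false | false = refl , eq
... | true | false = ⊥-elim (fib+zeckendorf≢zeckendorf noAdj' n w eq)
... | false | true = ⊥-elim (fib+zeckendorf≢zeckendorf noAdj n w' (sym eq))

zeckendorf-injective : ∀ {w w' n} → NoAdjacent w → NoAdjacent w' →
  zeckendorf w n ≡ zeckendorf w' n → ∀ {k} → k < n → w k ≡ w' k
zeckendorf-injective {n = suc n} noAdj noAdj' eq k<1+n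
  with zeckendorf-suc-injective noAdj noAdj' eq | ℕₚ.m<1+n⇒m<n∨m≡n k<1+n
... | top , _ | inj₂ refl = top
... | _ , rest | inj₁ k<n = zeckendorf-injective noAdj noAdj' rest k<n

-- Uniqueness of base φ expansions

-- The additive map a + bφ ↦ a + 2b sends φ^k to F_{k+2}, so it turns sums of
-- nonnegative powers of φ into Zeckendorf sums.
fibWeight : ZPhi → ℤ
fibWeight (a , b) = a ℤ.+ (b ℤ.+ b)

fibWeight-⊕ : ∀ x y → fibWeight (x ⊕ y) ≡ fibWeight x ℤ.+ fibWeight y
fibWeight-⊕ (a , b) (c , d) = lemma a b c d
  where
  lemma : ∀ a b c d → (a ℤ.+ c) ℤ.+ ((b ℤ.+ d) ℤ.+ (b ℤ.+ d)) ≡ (a ℤ.+ (b ℤ.+ b)) ℤ.+ (c ℤ.+ (d ℤ.+ d))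
  lemma = solve-∀

fibWeight-mulφ² : ∀ x → fibWeight (mulφ (mulφ x)) ≡ fibWeight (mulφ x) ℤ.+ fibWeight x
fibWeight-mulφ² x = trans (cong fibWeight (mulφ² x)) (fibWeight-⊕ (mulφ x) x)

fibWeight-φ^ : ∀ k → fibWeight (φ^ k) ≡ + fib (2 ℕ.+ k)
fibWeight-φ^ zero = refl
fibWeight-φ^ (suc zero) = refl
fibWeight-φ^ (suc (suc k)) =
  trans (fibWeight-mulφ² (φ^ k)) (cong₂ ℤ._+_ (fibWeight-φ^ (suc k)) (fibWeight-φ^ k))

fibWeight-sumRange : ∀ d K n →
  fibWeight (iter mulφ K (sumRange d (ℤ.- + K) n)) ≡ + zeckendorf (λ k → d (ℤ.- + K ℤ.+ + k)) n
fibWeight-sumRange d K zero = cong fibWeight (mulφ^-zero K)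
fibWeight-sumRange d K (suc n) = begin
  fibWeight (iter mulφ K (digitVal d i ⊕ sumRange d (ℤ.- + K) n))
    ≡⟨ cong fibWeight (mulφ^-⊕ K (digitVal d i) (sumRange d (ℤ.- + K) n)) ⟩
  fibWeight (iter mulφ K (digitVal d i) ⊕ iter mulφ K (sumRange d (ℤ.- + K) n))
    ≡⟨ fibWeight-⊕ (iter mulφ K (digitVal d i)) _ ⟩
  fibWeight (iter mulφ K (digitVal d i)) ℤ.+ fibWeight (iter mulφ K (sumRange d (ℤ.- + K) n))
    ≡⟨ cong₂ ℤ._+_ digit (fibWeight-sumRange d K n) ⟩
  + zeckendorf (λ k → d (ℤ.- + K ℤ.+ + k)) (suc n) ∎
  where
  i = ℤ.- + K ℤ.+ + n
  digit : fibWeight (iter mulφ K (digitVal d i)) ≡ + (if d i then fib (2 ℕ.+ n) else 0)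
  digit with d i
  ... | false = cong fibWeight (mulφ^-zero K)
  ... | true = begin
    fibWeight (iter mulφ K (phiPow i))  ≡⟨ cong fibWeight (mulφ^-phiPow K i) ⟩
    fibWeight (phiPow (i ℤ.+ + K))      ≡⟨ cong (fibWeight ∘ phiPow) (back (+ K) (+ n)) ⟩
    fibWeight (φ^ n)                    ≡⟨ fibWeight-φ^ n ⟩
    + fib (2 ℕ.+ n)                     ∎
    where
    back : ∀ k m → ℤ.- k ℤ.+ m ℤ.+ k ≡ m
    back = solve-∀

window : (ℤ → Bool) → ℕ → ZPhi
window d K = sumRange d (ℤ.- + K) (suc (2 * K))

-m+[m+n]≡n : ∀ m n → ℤ.- + m ℤ.+ + (m ℕ.+ n) ≡ + n
-m+[m+n]≡n m n = begin
  ℤ.- + m ℤ.+ + (m ℕ.+ n)  ≡⟨ ℤₚ.-m+n≡n⊖m m (m ℕ.+ n) ⟩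
  (m ℕ.+ n) ℤ.⊖ m          ≡⟨ ℤₚ.⊖-≥ (ℕₚ.m≤m+n m n) ⟩
  + (m ℕ.+ n ∸ m)          ≡⟨ cong +_ (ℕₚ.m+n∸m≡n m n) ⟩
  + n                      ∎

window-suc : ∀ d K → d (+ suc K) ≡ false → d -[1+ K ] ≡ false → window d (suc K) ≡ window d K
window-suc d K top bottom = begin
  window d (suc K)
    ≡⟨ cong (sumRange d -[1+ K ] ∘ suc) (ℕₚ.*-suc 2 K) ⟩
  digitVal d (-[1+ K ] ℤ.+ + (2 ℕ.+ 2 * K)) ⊕ sumRange d -[1+ K ] (2 ℕ.+ 2 * K)
    ≡⟨ cong₂ _⊕_ (trans (cong (digitVal d) top-index) (digitVal-false d _ top))
                 (sumRange-extendˡ d -[1+ K ] (suc (2 * K)) (-[1+m]+1 K)) ⟩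
  zeroΦ ⊕ (window d K ⊕ digitVal d -[1+ K ])
    ≡⟨ ⊕-identityˡ _ ⟩
  window d K ⊕ digitVal d -[1+ K ]
    ≡⟨ cong (window d K ⊕_) (digitVal-false d _ bottom) ⟩
  window d K ⊕ zeroΦ
    ≡⟨ ⊕-identityʳ _ ⟩
  window d K ∎
  where
  top-index : -[1+ K ] ℤ.+ + (2 ℕ.+ 2 * K) ≡ + suc K
  top-index = trans (cong (λ n → -[1+ K ] ℤ.+ + n) (twice K)) (-m+[m+n]≡n (suc K) (suc K))
    where
    twice : ∀ n → 2 ℕ.+ 2 * n ≡ suc n ℕ.+ suc n
    twice = ℕ-Solver.solve-∀
  -[1+m]+1 : ∀ m → -[1+ m ] ℤ.+ + 1 ≡ ℤ.- + m
  -[1+m]+1 zero = refl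
  -[1+m]+1 (suc m) = refl

module _ {N : ℕ} (e : Expansion N) where
  open Expansion e

  window-value : ∀ {K} → M ≤ K → window d K ≡ (+ N , + 0)
  window-value {zero} z≤n = value
  window-value {suc K} M≤1+K with ℕₚ.m≤n⇒m<n∨m≡n M≤1+K
  ... | inj₂ refl = value
  ... | inj₁ (s≤s M≤K) =
    trans (window-suc d K (finite _ (s≤s M≤K)) (finite _ (s≤s M≤K))) (window-value M≤K)

  noAdjacent-shifted : ∀ K → NoAdjacent (λ k → d (ℤ.- + K ℤ.+ + k))
  noAdjacent-shifted K k dk = trans (cong d index) (noAdj _ dk)
    where
    index : ℤ.- + K ℤ.+ + suc k ≡ ℤ.- + K ℤ.+ + k ℤ.+ + 1
    index = trans (cong (λ n → ℤ.- + K ℤ.+ + n) (ℕₚ.+-comm 1 k)) (sym (ℤₚ.+-assoc (ℤ.- + K) (+ k) (+ 1)))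

window-index : ∀ {K} i → ∣ i ∣ ≤ K → Σ[ k ∈ ℕ ] k < suc (2 * K) × ℤ.- + K ℤ.+ + k ≡ i
window-index {K} (+ n) n≤K =
  K ℕ.+ n , s≤s (ℕₚ.+-monoʳ-≤ K (ℕₚ.≤-trans n≤K (ℕₚ.m≤m+n K 0))) , -m+[m+n]≡n K n
window-index {K} -[1+ j ] j<K =
  K ∸ suc j , s≤s (ℕₚ.≤-trans (ℕₚ.m∸n≤m K (suc j)) (ℕₚ.m≤m+n K (K ℕ.+ 0))) , index
  where
  index : ℤ.- + K ℤ.+ + (K ∸ suc j) ≡ -[1+ j ]
  index = begin
    ℤ.- + K ℤ.+ + (K ∸ suc j)   ≡⟨ ℤₚ.-m+n≡n⊖m K (K ∸ suc j) ⟩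
    (K ∸ suc j) ℤ.⊖ K           ≡⟨ ℤₚ.⊖-≤ (ℕₚ.m∸n≤m K (suc j)) ⟩
    ℤ.- + (K ∸ (K ∸ suc j))     ≡⟨ cong (ℤ.-_ ∘ +_) (ℕₚ.m∸[m∸n]≡n j<K) ⟩
    -[1+ j ]                    ∎

module _ {N : ℕ} (e e' : Expansion N) where
  open Expansion e
  open Expansion e' renaming (d to d'; M to M'; finite to finite')

  private
    K = M ⊔ M'

  window-zeckendorf-equal :
    zeckendorf (λ k → d (ℤ.- + K ℤ.+ + k)) (suc (2 * K)) ≡ zeckendorf (λ k → d' (ℤ.- + K ℤ.+ + k)) (suc (2 * K))
  window-zeckendorf-equal = ℤₚ.+-injective (begin
    + zeckendorf (λ k → d (ℤ.- + K ℤ.+ + k)) (suc (2 * K))   ≡⟨ fibWeight-sumRange d K _ ⟨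
    fibWeight (iter mulφ K (window d K))                    ≡⟨ cong (fibWeight ∘ iter mulφ K) same-window ⟩
    fibWeight (iter mulφ K (window d' K))                   ≡⟨ fibWeight-sumRange d' K _ ⟩
    + zeckendorf (λ k → d' (ℤ.- + K ℤ.+ + k)) (suc (2 * K))  ∎)
    where
    same-window : window d K ≡ window d' K
    same-window = trans (window-value e (ℕₚ.m≤m⊔n M M')) (sym (window-value e' (ℕₚ.m≤n⊔m M M')))

  expansion-unique : ∀ i → d i ≡ d' i
  expansion-unique i with ∣ i ∣ ℕ.≤? K
  ... | no |i|≰K = trans (finite i (outside (ℕₚ.m≤m⊔n M M'))) (sym (finite' i (outside (ℕₚ.m≤n⊔m M M'))))
    where
    outside : ∀ {m} → m ≤ K → m < ∣ i ∣
    outside m≤K = ℕₚ.≤-<-trans m≤K (ℕₚ.≰⇒> |i|≰K)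
  ... | yes |i|≤K with window-index i |i|≤K
  ...   | k , k<2K+1 , refl =
    zeckendorf-injective (noAdjacent-shifted e K) (noAdjacent-shifted e' K) window-zeckendorf-equal k<2K+1

trimmedWord : (ℕ → Bool) → ℕ → List Bool
trimmedWord g n = reverse (dropFalse (reverse (map g (upTo n))))

trimmedWord-suc : ∀ g n → g n ≡ false → trimmedWord g (suc n) ≡ trimmedWord g n
trimmedWord-suc g n gn = cong (reverse ∘ dropFalse) (begin
  reverse (map g (upTo (suc n)))            ≡⟨ cong (reverse ∘ map g) (Listₚ.upTo-∷ʳ n) ⟨
  reverse (map g (upTo n ++ n ∷ []))        ≡⟨ cong reverse (Listₚ.map-++ g (upTo n) (n ∷ [])) ⟩
  reverse (map g (upTo n) ++ g n ∷ [])      ≡⟨ Listₚ.reverse-++ (map g (upTo n)) (g n ∷ []) ⟩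
  g n ∷ reverse (map g (upTo n))            ≡⟨ cong (_∷ reverse (map g (upTo n))) gn ⟩
  false ∷ reverse (map g (upTo n))          ∎)

trimmedWord-stable : ∀ g {n m} → (∀ {k} → n ≤ k → g k ≡ false) → n ≤ m → trimmedWord g m ≡ trimmedWord g n
trimmedWord-stable g {m = zero} _ z≤n = refl
trimmedWord-stable g {n} {suc m} zeros n≤1+m with ℕₚ.m≤n⇒m<n∨m≡n n≤1+m
... | inj₂ refl = refl
... | inj₁ (s≤s n≤m) = trans (trimmedWord-suc g m (zeros n≤m)) (trimmedWord-stable g zeros n≤m)

trimmedWord-cong : ∀ {g g'} n → (∀ k → g k ≡ g' k) → trimmedWord g n ≡ trimmedWord g' n
trimmedWord-cong n g≗g' = cong (reverse ∘ dropFalse ∘ reverse) (Listₚ.map-cong g≗g' (upTo n))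

betaMinus-unique : ∀ {N} (e e' : Expansion N) → betaMinus e ≡ betaMinus e'
betaMinus-unique e e' = begin
  trimmedWord g M               ≡⟨ trimmedWord-stable g (λ M≤k → finite _ (s≤s M≤k)) (ℕₚ.m≤m⊔n M M') ⟨
  trimmedWord g (M ⊔ M')        ≡⟨ trimmedWord-cong (M ⊔ M') (λ k → expansion-unique e e' -[1+ k ]) ⟩
  trimmedWord g' (M ⊔ M')       ≡⟨ trimmedWord-stable g' (λ M'≤k → finite' _ (s≤s M'≤k)) (ℕₚ.m≤n⊔m M M') ⟩
  trimmedWord g' M'             ∎
  where
  open Expansion e
  open Expansion e' renaming (d to d'; M to M'; finite to finite')
  g g' : ℕ → Bool
  g k = d -[1+ k ]
  g' k = d' -[1+ k ]

trident : ∀ {N} (e₀ : Expansion N) (e₁ : Expansion (suc N)) (e₂ : Expansion (2 ℕ.+ N)) →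
  betaMinus e₀ ≡ betaMinus e₁ → betaMinus e₁ ≡ betaMinus e₂ → Trident N
trident e₀ e₁ e₂ β₀≡β₁ β₁≡β₂ = (e₀ , e₁ , e₂) , λ e₀' e₁' e₂' →
  trans (betaMinus-unique e₀' e₀) (trans β₀≡β₁ (betaMinus-unique e₁ e₁')) ,
  trans (betaMinus-unique e₁' e₁) (trans β₁≡β₂ (betaMinus-unique e₂ e₂'))

-- Expansions of L_M - 1, L_M and L_M + 1 for even M

digitSum : (ℕ → Bool) → ℕ → ZPhi
digitSum w zero = zeroΦ
digitSum w (suc n) = (if w n then φ^ n else zeroΦ) ⊕ digitSum w n

digitSum-suc-true : ∀ w n → w n ≡ true → digitSum w (suc n) ≡ φ^ n ⊕ digitSum w n
digitSum-suc-true w n wn rewrite wn = refl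

digitSum-suc-false : ∀ w n → w n ≡ false → digitSum w (suc n) ≡ digitSum w n
digitSum-suc-false w n wn rewrite wn = ⊕-identityˡ _

digitSum-cong : ∀ {w w'} n → (∀ {k} → k < n → w k ≡ w' k) → digitSum w n ≡ digitSum w' n
digitSum-cong zero _ = refl
digitSum-cong (suc n) w≗w' =
  cong₂ _⊕_ (cong (λ b → if b then φ^ n else zeroΦ) (w≗w' ℕₚ.≤-refl))
            (digitSum-cong n (w≗w' ∘ ℕₚ.m<n⇒m<1+n))

digitSum-none : ∀ {w} n → (∀ {k} → k < n → w k ≡ false) → digitSum w n ≡ zeroΦ
digitSum-none zero _ = refl
digitSum-none (suc n) none =
  trans (digitSum-suc-false _ n (none ℕₚ.≤-refl)) (digitSum-none n (none ∘ ℕₚ.m<n⇒m<1+n))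

digitSum-single : ∀ {i} n → i < n → digitSum (λ k → does (k ≟ i)) n ≡ φ^ i
digitSum-single {i} (suc n) i<1+n with ℕₚ.m<1+n⇒m<n∨m≡n i<1+n
... | inj₂ refl = begin
  digitSum (λ k → does (k ≟ i)) (suc i)   ≡⟨ digitSum-suc-true (λ k → does (k ≟ i)) i (dec-true (i ≟ i) refl) ⟩
  φ^ i ⊕ digitSum (λ k → does (k ≟ i)) i  ≡⟨ cong (φ^ i ⊕_) (digitSum-none i (λ k<i → dec-false (_ ≟ i) (ℕₚ.<⇒≢ k<i))) ⟩
  φ^ i ⊕ zeroΦ                            ≡⟨ ⊕-identityʳ (φ^ i) ⟩
  φ^ i                                    ∎
... | inj₁ i<n = trans (digitSum-suc-false (λ k → does (k ≟ i)) n (dec-false (n ≟ i) (ℕₚ.>⇒≢ i<n))) (digitSum-single n i<n)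

sumRange-nonnegative : ∀ d n → sumRange d (+ 0) n ≡ digitSum (λ k → d (+ k)) n
sumRange-nonnegative d zero = refl
sumRange-nonnegative d (suc n) = cong (digitVal d (+ n) ⊕_) (sumRange-nonnegative d n)

sumRange-negative-none : ∀ d t → (∀ {j} → j ≤ t → d -[1+ j ] ≡ false) → sumRange d -[1+ t ] (suc t) ≡ zeroΦ
sumRange-negative-none d zero none = cong (_⊕ zeroΦ) (digitVal-false d _ (none z≤n))
sumRange-negative-none d (suc t) none = begin
  sumRange d -[1+ suc t ] (suc (suc t))
    ≡⟨ sumRange-extendˡ d -[1+ suc t ] (suc t) refl ⟩
  sumRange d -[1+ t ] (suc t) ⊕ digitVal d -[1+ suc t ]
    ≡⟨ cong₂ _⊕_ (sumRange-negative-none d t (none ∘ ℕₚ.m≤n⇒m≤1+n)) (digitVal-false d _ (none ℕₚ.≤-refl)) ⟩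
  zeroΦ ⊕ zeroΦ ∎

does-≟⇒≡ : ∀ m n → does (m ≟ n) ≡ true → m ≡ n
does-≟⇒≡ m n eq = ℕₚ.≡ᵇ⇒≡ m n (Equivalence.from Boolₚ.T-≡ eq)

-- digits w at the positions i ≥ 0, and a single 1 at the position -(2 + m)
withNegativeDigit : ℕ → (ℕ → Bool) → ℤ → Bool
withNegativeDigit m w (+ i) = w i
withNegativeDigit m w -[1+ j ] = does (j ≟ suc m)

module _ (m : ℕ) (w : ℕ → Bool) where
  private
    d = withNegativeDigit m w

  window-withNegativeDigit : window (withNegativeDigit m w) (2 ℕ.+ m) ≡ digitSum w (3 ℕ.+ m) ⊕ φ^- (2 ℕ.+ m)
  window-withNegativeDigit = begin
    sumRange d -[1+ suc m ] (suc (2 * (2 ℕ.+ m)))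
      ≡⟨ cong (sumRange d -[1+ suc m ]) (split m) ⟩
    sumRange d -[1+ suc m ] ((2 ℕ.+ m) ℕ.+ (3 ℕ.+ m))
      ≡⟨ sumRange-++ d -[1+ suc m ] (2 ℕ.+ m) (3 ℕ.+ m) ⟩
    sumRange d ((2 ℕ.+ m) ℤ.⊖ (2 ℕ.+ m)) (3 ℕ.+ m) ⊕ sumRange d -[1+ suc m ] (2 ℕ.+ m)
      ≡⟨ cong₂ _⊕_ nonnegative negative ⟩
    digitSum w (3 ℕ.+ m) ⊕ φ^- (2 ℕ.+ m) ∎
    where
    split : ∀ n → suc (2 * (2 ℕ.+ n)) ≡ (2 ℕ.+ n) ℕ.+ (3 ℕ.+ n)
    split = ℕ-Solver.solve-∀
    nonnegative : sumRange d ((2 ℕ.+ m) ℤ.⊖ (2 ℕ.+ m)) (3 ℕ.+ m) ≡ digitSum w (3 ℕ.+ m)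
    nonnegative = trans (cong (λ lo → sumRange d lo (3 ℕ.+ m)) (ℤₚ.n⊖n≡0 (2 ℕ.+ m))) (sumRange-nonnegative d (3 ℕ.+ m))
    negative : sumRange d -[1+ suc m ] (2 ℕ.+ m) ≡ φ^- (2 ℕ.+ m)
    negative = begin
      sumRange d -[1+ suc m ] (2 ℕ.+ m)
        ≡⟨ sumRange-extendˡ d -[1+ suc m ] (suc m) refl ⟩
      sumRange d -[1+ m ] (suc m) ⊕ digitVal d -[1+ suc m ]
        ≡⟨ cong₂ _⊕_ (sumRange-negative-none d m (λ j≤m → dec-false (_ ≟ suc m) (ℕₚ.<⇒≢ (s≤s j≤m))))
                     (cong (λ b → if b then φ^- (2 ℕ.+ m) else zeroΦ) (dec-true (suc m ≟ suc m) refl)) ⟩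
      zeroΦ ⊕ φ^- (2 ℕ.+ m)
        ≡⟨ ⊕-identityˡ _ ⟩
      φ^- (2 ℕ.+ m) ∎

  expansion-withNegativeDigit : ∀ {N} → (∀ {k} → 2 ℕ.+ m < k → w k ≡ false) → NoAdjacent w →
    digitSum w (3 ℕ.+ m) ⊕ φ^- (2 ℕ.+ m) ≡ (+ N , + 0) → Expansion N
  expansion-withNegativeDigit vanishes noAdj sum = record
    { d = withNegativeDigit m w
    ; M = 2 ℕ.+ m
    ; finite = finite
    ; noAdj = noAdj'
    ; value = trans window-withNegativeDigit sum
    }
    where
    finite : ∀ i → 2 ℕ.+ m < ∣ i ∣ → d i ≡ false
    finite (+ k) M<k = vanishes M<k
    finite -[1+ j ] (s≤s M<j) = dec-false (j ≟ suc m) (ℕₚ.>⇒≢ M<j)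
    noAdj' : ∀ i → d i ≡ true → d (i ℤ.+ + 1) ≡ false
    noAdj' (+ k) wk = trans (cong w (ℕₚ.+-comm k 1)) (noAdj k wk)
    noAdj' -[1+ j ] dj with refl ← does-≟⇒≡ j (suc m) dj =
      dec-false (m ≟ suc m) (ℕₚ.<⇒≢ ℕₚ.≤-refl)

odd : ℕ → Bool
odd zero = false
odd (suc n) = not (odd n)

odd-2* : ∀ j → odd (2 * j) ≡ false
odd-2* zero = refl
odd-2* (suc j) = begin
  odd (2 * suc j)          ≡⟨ cong odd (ℕₚ.*-suc 2 j) ⟩
  not (not (odd (2 * j)))  ≡⟨ Boolₚ.not-involutive (odd (2 * j)) ⟩
  odd (2 * j)              ≡⟨ odd-2* j ⟩
  false                    ∎

digitSum-odd : ∀ j → digitSum odd (2 * j) ⊕ oneΦ ≡ φ^ (2 * j)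
digitSum-odd zero = refl
digitSum-odd (suc j) = begin
  digitSum odd (2 * suc j) ⊕ oneΦ           ≡⟨ cong (λ n → digitSum odd n ⊕ oneΦ) (ℕₚ.*-suc 2 j) ⟩
  digitSum odd (2 ℕ.+ k) ⊕ oneΦ             ≡⟨ cong (_⊕ oneΦ) top-digits ⟩
  (φ^ suc k ⊕ digitSum odd k) ⊕ oneΦ        ≡⟨ ⊕-assoc (φ^ suc k) (digitSum odd k) oneΦ ⟩
  φ^ suc k ⊕ (digitSum odd k ⊕ oneΦ)        ≡⟨ cong (φ^ suc k ⊕_) (digitSum-odd j) ⟩
  φ^ suc k ⊕ φ^ k                           ≡⟨ mulφ² (φ^ k) ⟨
  φ^ (2 ℕ.+ k)                              ≡⟨ cong φ^_ (ℕₚ.*-suc 2 j) ⟨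
  φ^ (2 * suc j)                            ∎
  where
  k = 2 * j
  top-digits : digitSum odd (2 ℕ.+ k) ≡ φ^ suc k ⊕ digitSum odd k
  top-digits = trans (digitSum-suc-true odd (suc k) (cong not (odd-2* j)))
                     (cong (φ^ suc k ⊕_) (digitSum-suc-false odd k (odd-2* j)))

L-positive : ∀ k → 1 ≤ L k
L-positive zero = s≤s z≤n
L-positive (suc zero) = s≤s z≤n
L-positive (suc (suc k)) = ℕₚ.≤-trans (L-positive (suc k)) (ℕₚ.m≤m+n (L (suc k)) (L k))

module _ (p : ℕ) where
  private
    M = 2 ℕ.+ 2 * p

    lucas : φ^ M ⊕ φ^- M ≡ (+ L M , + 0)
    lucas = subst (λ n → φ^ n ⊕ φ^- n ≡ (+ L n , + 0)) (ℕₚ.*-suc 2 p) (lucas-even (suc p))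

    odd-powers : digitSum odd M ⊕ oneΦ ≡ φ^ M
    odd-powers = subst (λ n → digitSum odd n ⊕ oneΦ ≡ φ^ n) (ℕₚ.*-suc 2 p) (digitSum-odd (suc p))

    L-pred : (+ L M , + 0) ≡ oneΦ ⊕ (+ (L M ∸ 1) , + 0)
    L-pred = cong (λ n → (+ n , + 0)) (sym (ℕₚ.m+[n∸m]≡n (L-positive M)))

    w₀ w₁ w₂ : ℕ → Bool
    w₀ k = odd k ∧ does (k <? M)
    w₁ k = does (k ≟ M)
    w₂ k = does (k ≟ M) ∨ does (k ≟ 0)

    e₀ : Expansion (L M ∸ 1)
    e₀ = expansion-withNegativeDigit (2 * p) w₀ vanishes noAdj (⊕-cancelˡ oneΦ _ _ (begin
      oneΦ ⊕ (digitSum w₀ (suc M) ⊕ φ^- M)   ≡⟨ cong (λ x → oneΦ ⊕ (x ⊕ φ^- M)) below ⟩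
      oneΦ ⊕ (digitSum odd M ⊕ φ^- M)        ≡⟨ ⊕-exchange (digitSum odd M) oneΦ (φ^- M) ⟨
      (digitSum odd M ⊕ oneΦ) ⊕ φ^- M        ≡⟨ cong (_⊕ φ^- M) odd-powers ⟩
      φ^ M ⊕ φ^- M                           ≡⟨ lucas ⟩
      (+ L M , + 0)                          ≡⟨ L-pred ⟩
      oneΦ ⊕ (+ (L M ∸ 1) , + 0)             ∎))
      where
      vanishes : ∀ {k} → M < k → w₀ k ≡ false
      vanishes {k} M<k =
        trans (cong (odd k ∧_) (dec-false (k <? M) (λ k<M → ℕₚ.<-asym k<M M<k))) (Boolₚ.∧-zeroʳ (odd k))
      noAdj : NoAdjacent w₀
      noAdj k w₀k with odd k | w₀k
      ... | true | _ = refl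
      below : digitSum w₀ (suc M) ≡ digitSum odd M
      below = trans (digitSum-suc-false w₀ M (trans (cong (odd M ∧_) (dec-false (M <? M) (ℕₚ.<-irrefl refl)))
                                                    (Boolₚ.∧-zeroʳ (odd M))))
                    (digitSum-cong M (λ {k} k<M → trans (cong (odd k ∧_) (dec-true (k <? M) k<M))
                                                        (Boolₚ.∧-identityʳ (odd k))))

    e₁ : Expansion (suc (L M ∸ 1))
    e₁ = expansion-withNegativeDigit (2 * p) w₁ vanishes noAdj (begin
      digitSum w₁ (suc M) ⊕ φ^- M  ≡⟨ cong (_⊕ φ^- M) (digitSum-single (suc M) ℕₚ.≤-refl) ⟩
      φ^ M ⊕ φ^- M                 ≡⟨ lucas ⟩
      (+ L M , + 0)                ≡⟨ L-pred ⟩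
      oneΦ ⊕ (+ (L M ∸ 1) , + 0)   ∎)
      where
      vanishes : ∀ {k} → M < k → w₁ k ≡ false
      vanishes M<k = dec-false (_ ≟ M) (ℕₚ.>⇒≢ M<k)
      noAdj : NoAdjacent w₁
      noAdj k w₁k with refl ← does-≟⇒≡ k M w₁k = dec-false (suc M ≟ M) ℕₚ.1+n≢n

    e₂ : Expansion (2 ℕ.+ (L M ∸ 1))
    e₂ = expansion-withNegativeDigit (2 * p) w₂ vanishes noAdj (begin
      digitSum w₂ (suc M) ⊕ φ^- M             ≡⟨ cong (_⊕ φ^- M) digits ⟩
      (φ^ M ⊕ oneΦ) ⊕ φ^- M                   ≡⟨ ⊕-exchange (φ^ M) oneΦ (φ^- M) ⟩
      oneΦ ⊕ (φ^ M ⊕ φ^- M)                   ≡⟨ cong (oneΦ ⊕_) (trans lucas L-pred) ⟩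
      oneΦ ⊕ (oneΦ ⊕ (+ (L M ∸ 1) , + 0))     ∎)
      where
      vanishes : ∀ {k} → M < k → w₂ k ≡ false
      vanishes M<k = cong₂ _∨_ (dec-false (_ ≟ M) (ℕₚ.>⇒≢ M<k)) (dec-false (_ ≟ 0) (ℕₚ.m<n⇒n≢0 M<k))
      noAdj : NoAdjacent w₂
      noAdj zero _ = refl
      noAdj (suc k) w₂k with refl ← does-≟⇒≡ (suc k) M (trans (sym (Boolₚ.∨-identityʳ _)) w₂k) =
        trans (Boolₚ.∨-identityʳ _) (dec-false (suc M ≟ M) ℕₚ.1+n≢n)
      digits : digitSum w₂ (suc M) ≡ φ^ M ⊕ oneΦ
      digits = trans (digitSum-suc-true w₂ M (cong (_∨ does (M ≟ 0)) (dec-true (M ≟ M) refl)))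
                     (cong (φ^ M ⊕_) (trans (digitSum-cong M only-zero) (digitSum-single M (s≤s z≤n))))
        where
        only-zero : ∀ {k} → k < M → w₂ k ≡ does (k ≟ 0)
        only-zero {k} k<M = cong (_∨ does (k ≟ 0)) (dec-false (k ≟ M) (ℕₚ.<⇒≢ k<M))

  -- The three expansions share their negative digits, so their β⁻ agree by computation.
  lucas-trident : Trident (L M ∸ 1)
  lucas-trident = trident e₀ e₁ e₂ refl refl

lemma7p1 : ∀ (n : ℕ) → 1 ≤ n → Trident (L (2 * n) ∸ 1)
lemma7p1 (suc p) _ = subst (λ M → Trident (L M ∸ 1)) (sym (ℕₚ.*-suc 2 p)) (lucas-trident p)
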